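{- Let $cousin(n)$ denote the number of $n$-totative numbers $t$ such that $t+4$ is also $n$-totative. Then $cousin(1)=cousin(2)=0$, $cousin(3)=3$, and $cousin(n)=(p_n-2)\,cousin(n-1)$ for all $n>3$.
   Context: $p_i$ denotes the $i$th prime. The primorial is $\#(m)=\prod_{i=1}^{m}p_i$. The $m$-primorial set is $\{2,\ldots,\#(m)+1\}$, and an $m$-totative number is an element of it coprime to $\#(m)$. -}

module Defs where

open import Data.Nat using (ℕ; zero; suc; _+_; _*_; _<_; _≤_; _<?_; _≤?_; _!)
open import Data.Nat.Primality using (Prime; prime?)
open import Data.Nat.Coprimality using (Coprime; coprime?)
open import Data.Product using (_×_)
open import Data.List using (List; []; _∷_; length; filter; applyUpTo)
open import Relation.Nullary using (Dec; yes; no; _×-dec_)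

firstPrimeFrom : ℕ → ℕ → ℕ → ℕ
firstPrimeFrom lo zero    d = d
firstPrimeFrom lo (suc k) d with prime? lo
... | yes _ = lo
... | no  _ = firstPrimeFrom (suc lo) k d

-- least prime strictly greater than n; by Euclid such a prime
-- exists in (n, n! + 1], so the bounded search is exhaustive.
nextPrime : ℕ → ℕ
nextPrime n = firstPrimeFrom (suc n) (n !) 0

-- p i : the i-th prime, 1-indexed (p 1 = 2, p 2 = 3, ...); p 0 = 1 is a
-- dummy value never used by the statement.
p : ℕ → ℕ
p zero    = 1
p (suc i) = nextPrime (p i)

primorial : ℕ → ℕ
primorial zero    = 1
primorial (suc m) = primorial m * p (suc m)

primorialSet : ℕ → List ℕ
primorialSet m = applyUpTo (λ k → 2 + k) (primorial m)

Totative : ℕ → ℕ → Set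
Totative m t = (2 ≤ t) × (t ≤ primorial m + 1) × Coprime t (primorial m)

totative? : (m t : ℕ) → Dec (Totative m t)
totative? m t = (2 ≤? t) ×-dec ((t ≤? primorial m + 1) ×-dec coprime? t (primorial m))

cousin : ℕ → ℕ
cousin m = length (filter (λ t → totative? m t ×-dec totative? m (t + 4)) (primorialSet m))

-- Since 30 ∣ #(m) for m ≥ 3, every t near the top of the window {2, …, #(m)+1} has t or t + 4
-- sharing one of the factors 2, 3, 5 with #(m); so the bound t + 4 ≤ #(m)+1 in the definition of
-- cousin(m) is automatic, and cousin(m) counts the residues t mod #(m) with t and t + 4 both prime
-- to #(m).  Writing the residues mod P·q as t = jP + i with i < P and j < q, where q = pₙ is a new
-- prime and P = #(n-1), the condition splits into one on i mod P and one on t mod q.  For fixed i,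
-- as j runs over 0, …, q-1 the number jP + i meets every residue mod q exactly once, so exactly
-- q - 2 values of j keep both t and t + 4 prime to q (as q > 4), and the count gains the factor pₙ - 2.

module Submission where

open import Data.List using ([]; _∷_; length; filter; applyUpTo)
open import Data.List.Relation.Unary.All using (_∷_)
open import Data.Nat
open import Data.Nat.Coprimality using (Coprime; coprime?; coprime-divisor; coprime-Bézout)
open import Data.Nat.Divisibility
open import Data.Nat.DivMod
open import Data.Nat.GCD using (module Bézout)
open import Data.Nat.ListAction using (product)
open import Data.Nat.Primality
open import Data.Nat.Primality.Factorisation
open import Data.Nat.Properties
open import Data.Nat.Tactic.RingSolver using (solve-∀)
open import Algebra.Properties.CommutativeSemigroup +-commutativeSemigroup using (interchange; x∙yz≈y∙xz)
open import Data.Product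
open import Data.Product.Function.NonDependent.Propositional using (_×-⇔_)
open import Data.Sum using (inj₁; inj₂)
open import Function using (_∘_)
open import Function.Bundles using (_⇔_; mk⇔; Equivalence)
open import Relation.Binary.PropositionalEquality
open import Relation.Nullary
open import Relation.Unary using (Decidable)

open import Defs

private
  variable
    A B : Set
    a c d m n q t P : ℕ

𝟙 : Dec A → ℕ
𝟙 (yes _) = 1
𝟙 (no _)  = 0

𝟙-yes : A → (a? : Dec A) → 𝟙 a? ≡ 1
𝟙-yes a (yes _) = refl
𝟙-yes a (no ¬a) = contradiction a ¬a

𝟙-no : ¬ A → (a? : Dec A) → 𝟙 a? ≡ 0
𝟙-no ¬a (yes a) = contradiction a ¬a
𝟙-no ¬a (no _)  = refl

𝟙-cong : A ⇔ B → (a? : Dec A) (b? : Dec B) → 𝟙 a? ≡ 𝟙 b?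
𝟙-cong A⇔B (yes a) b?      = sym (𝟙-yes (Equivalence.to A⇔B a) b?)
𝟙-cong A⇔B (no ¬a) b?      = sym (𝟙-no (¬a ∘ Equivalence.from A⇔B) b?)

𝟙-× : (a? : Dec A) (b? : Dec B) → 𝟙 (a? ×-dec b?) ≡ 𝟙 a? * 𝟙 b?
𝟙-× (yes _) (yes _) = refl
𝟙-× (yes _) (no _)  = refl
𝟙-× (no _)  _       = refl

𝟙-partition : ¬ (A × B) → (a? : Dec A) (b? : Dec B) → 𝟙 (¬? a? ×-dec ¬? b?) + (𝟙 a? + 𝟙 b?) ≡ 1
𝟙-partition ¬a×b (yes a) (yes b) = contradiction (a , b) ¬a×b
𝟙-partition ¬a×b (yes _) (no _)  = refl
𝟙-partition ¬a×b (no _)  (yes _) = refl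
𝟙-partition ¬a×b (no _)  (no _)  = refl

∑ : ℕ → (ℕ → ℕ) → ℕ
∑ zero    f = 0
∑ (suc k) f = f 0 + ∑ k (f ∘ suc)

syntax ∑ k (λ i → e) = ∑[ i < k ] e

∑-cong : ∀ k {f g : ℕ → ℕ} → (∀ i → i < k → f i ≡ g i) → ∑ k f ≡ ∑ k g
∑-cong zero    f≗g = refl
∑-cong (suc k) f≗g = cong₂ _+_ (f≗g 0 z<s) (∑-cong k (λ i i<k → f≗g (suc i) (s<s i<k)))

∑-const : ∀ k c → ∑[ _ < k ] c ≡ k * c
∑-const zero    c = refl
∑-const (suc k) c = cong (c +_) (∑-const k c)

∑-+ : ∀ k (f g : ℕ → ℕ) → ∑[ i < k ] (f i + g i) ≡ ∑ k f + ∑ k g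
∑-+ zero    f g = refl
∑-+ (suc k) f g = trans (cong (f 0 + g 0 +_) (∑-+ k (f ∘ suc) (g ∘ suc))) (interchange (f 0) (g 0) _ _)

∑-*ˡ : ∀ k c (f : ℕ → ℕ) → ∑[ i < k ] (c * f i) ≡ c * ∑ k f
∑-*ˡ zero    c f = sym (*-zeroʳ c)
∑-*ˡ (suc k) c f = trans (cong (c * f 0 +_) (∑-*ˡ k c (f ∘ suc))) (sym (*-distribˡ-+ c (f 0) _))

∑-*ʳ : ∀ k c (f : ℕ → ℕ) → ∑[ i < k ] (f i * c) ≡ ∑ k f * c
∑-*ʳ zero    c f = refl
∑-*ʳ (suc k) c f = trans (cong (f 0 * c +_) (∑-*ʳ k c (f ∘ suc))) (sym (*-distribʳ-+ c (f 0) _))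

∑-comm : ∀ a b (F : ℕ → ℕ → ℕ) → ∑[ j < b ] ∑[ i < a ] F i j ≡ ∑[ i < a ] ∑[ j < b ] F i j
∑-comm a zero    F = trans (sym (*-zeroʳ a)) (sym (∑-const a 0))
∑-comm a (suc b) F = trans (cong (∑[ i < a ] F i 0 +_) (∑-comm a b (λ i j → F i (suc j))))
                           (sym (∑-+ a (λ i → F i 0) (λ i → ∑[ j < b ] F i (suc j))))

∑-split : ∀ a b (f : ℕ → ℕ) → ∑ (a + b) f ≡ ∑ a f + ∑[ i < b ] f (a + i)
∑-split zero    b f = refl
∑-split (suc a) b f = trans (cong (f 0 +_) (∑-split a b (f ∘ suc))) (sym (+-assoc (f 0) _ _))

∑-blocks : ∀ q P (f : ℕ → ℕ) → ∑ (q * P) f ≡ ∑[ j < q ] ∑[ i < P ] f (j * P + i)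
∑-blocks zero    P f = refl
∑-blocks (suc q) P f = begin
  ∑ (P + q * P) f
    ≡⟨ ∑-split P (q * P) f ⟩
  ∑ P f + ∑[ t < q * P ] f (P + t)
    ≡⟨ cong (∑ P f +_) (∑-blocks q P (λ t → f (P + t))) ⟩
  ∑ P f + ∑[ j < q ] ∑[ i < P ] f (P + (j * P + i))
    ≡⟨ cong (∑ P f +_) (∑-cong q λ j _ → ∑-cong P λ i _ → cong f (sym (+-assoc P (j * P) i))) ⟩
  ∑ P f + ∑[ j < q ] ∑[ i < P ] f (suc j * P + i) ∎
  where open ≡-Reasoning

∑-last : ∀ k (f : ℕ → ℕ) → ∑ (suc k) f ≡ ∑ k f + f k
∑-last zero    f = +-comm (f 0) 0
∑-last (suc k) f = trans (cong (f 0 +_) (∑-last k (f ∘ suc))) (sym (+-assoc (f 0) _ _))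

∑-rotate : ∀ k (f : ℕ → ℕ) → f k ≡ f 0 → ∑[ i < k ] f (suc i) ≡ ∑ k f
∑-rotate k f fk≡f0 = +-cancelˡ-≡ (f 0) _ _ (begin
  f 0 + ∑[ i < k ] f (suc i)  ≡⟨ ∑-last k f ⟩
  ∑ k f + f k                 ≡⟨ cong (∑ k f +_) fk≡f0 ⟩
  ∑ k f + f 0                 ≡⟨ +-comm (∑ k f) (f 0) ⟩
  f 0 + ∑ k f                 ∎)
  where open ≡-Reasoning

∑-periodic : ∀ M (f : ℕ → ℕ) → (∀ t → f (M + t) ≡ f t) → ∀ c → ∑[ i < M ] f (c + i) ≡ ∑ M f
∑-periodic M f periodic zero    = refl
∑-periodic M f periodic (suc c) = begin
  ∑[ i < M ] f (suc c + i)    ≡⟨ ∑-cong M (λ i _ → cong f (sym (+-suc c i))) ⟩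
  ∑[ i < M ] f (c + suc i)    ≡⟨ ∑-rotate M (λ i → f (c + i)) wraps ⟩
  ∑[ i < M ] f (c + i)        ≡⟨ ∑-periodic M f periodic c ⟩
  ∑ M f                       ∎
  where
  open ≡-Reasoning
  wraps : f (c + M) ≡ f (c + 0)
  wraps = trans (cong f (+-comm c M)) (trans (periodic c) (cong f (sym (+-identityʳ c))))

∑-𝟙-unique : ∀ {D : ℕ → Set} (D? : Decidable D) k j → j < k → D j →
             (∀ i → i < k → D i → i ≡ j) → ∑[ i < k ] 𝟙 (D? i) ≡ 1
∑-𝟙-unique D? (suc k) zero    _       d0 unique =
  cong₂ _+_ (𝟙-yes d0 (D? 0))
            (trans (∑-cong k (λ i i<k → 𝟙-no (1+n≢0 ∘ unique (suc i) (s<s i<k)) (D? (suc i))))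
                   (trans (∑-const k 0) (*-zeroʳ k)))
∑-𝟙-unique D? (suc k) (suc j) (s<s j<k) dj unique =
  cong₂ _+_ (𝟙-no (0≢1+n ∘ unique 0 z<s) (D? 0))
            (∑-𝟙-unique (D? ∘ suc) k j j<k dj (λ i i<k d → cong pred (unique (suc i) (s<s i<k) d)))

length-filter-applyUpTo : ∀ {P : ℕ → Set} (P? : Decidable P) g k →
                          length (filter P? (applyUpTo g k)) ≡ ∑[ i < k ] 𝟙 (P? (g i))
length-filter-applyUpTo P? g zero = refl
length-filter-applyUpTo P? g (suc k) with P? (g 0)
... | yes _ = cong suc (length-filter-applyUpTo P? (g ∘ suc) k)
... | no  _ = length-filter-applyUpTo P? (g ∘ suc) k

prime≢1 : Prime q → q ≢ 1
prime≢1 q-prime = nonTrivial⇒≢1 {{prime⇒nonTrivial q-prime}}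

coprime-*⇔ : Coprime t (m * n) ⇔ (Coprime t m × Coprime t n)
coprime-*⇔ {t} {m} {n} = mk⇔
  (λ t⊥mn → (λ {d} (d∣t , d∣m) → t⊥mn (d∣t , ∣m⇒∣m*n n d∣m))
           , (λ {d} (d∣t , d∣n) → t⊥mn (d∣t , ∣n⇒∣m*n m d∣n)))
  (λ (t⊥m , t⊥n) {d} (d∣t , d∣mn) →
     t⊥n (d∣t , coprime-divisor (λ {e} (e∣d , e∣m) → t⊥m (∣-trans e∣d d∣t , e∣m)) d∣mn))

coprime-prime⇔ : Prime q → Coprime t q ⇔ (¬ q ∣ t)
coprime-prime⇔ {q} {t} q-prime = mk⇔ (λ t⊥q q∣t → prime≢1 q-prime (t⊥q (q∣t , ∣-refl))) coprime
  where
  coprime : ¬ q ∣ t → Coprime t q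
  coprime q∤t (d∣t , d∣q) with prime⇒irreducible q-prime d∣q
  ... | inj₁ d≡1  = d≡1
  ... | inj₂ refl = contradiction d∣t q∤t

coprime-*-prime⇔ : Prime q → Coprime t (P * q) ⇔ (Coprime t P × ¬ q ∣ t)
coprime-*-prime⇔ q-prime = mk⇔ (map₂ (to (coprime-prime⇔ q-prime)) ∘ to coprime-*⇔)
                               (from coprime-*⇔ ∘ map₂ (from (coprime-prime⇔ q-prime)))
  where open Equivalence

coprime-periodic : ∀ {M t} k → Coprime (k * M + t) M ⇔ Coprime t M
coprime-periodic {M} {t} k = mk⇔
  (λ x⊥M {d} (d∣t , d∣M) → x⊥M (∣m∣n⇒∣m+n (∣n⇒∣m*n k d∣M) d∣t , d∣M))
  (λ t⊥M {d} (d∣x , d∣M) → t⊥M (∣m+n∣m⇒∣n d∣x (∣n⇒∣m*n k d∣M) , d∣M))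

∃-negative-inverse : Coprime P q → .{{NonZero q}} → ∃[ x ] q ∣ x * P + 1
∃-negative-inverse {P} {suc q-1} P⊥q with coprime-Bézout P⊥q
... | Bézout.-+ x y 1+xP≡yq = x , divides y (trans (+-comm (x * P) 1) 1+xP≡yq)
... | Bézout.+- x y 1+yq≡xP = q-1 * x , divides (1 + q-1 * y) (begin
  q-1 * x * P + 1             ≡⟨ cong (_+ 1) (*-assoc q-1 x P) ⟩
  q-1 * (x * P) + 1           ≡⟨ cong (λ z → q-1 * z + 1) (sym 1+yq≡xP) ⟩
  q-1 * (1 + y * suc q-1) + 1 ≡⟨ rearrange q-1 y ⟩
  (1 + q-1 * y) * suc q-1     ∎)
  where
  open ≡-Reasoning
  rearrange : ∀ q-1 y → q-1 * (1 + y * suc q-1) + 1 ≡ (1 + q-1 * y) * suc q-1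
  rearrange = solve-∀

∣-reduce-coefficient : ∀ j P c .{{_ : NonZero q}} → q ∣ j * P + c → q ∣ (j % q) * P + c
∣-reduce-coefficient {q} j P c q∣jP+c = ∣m+n∣m⇒∣n (subst (q ∣_) split q∣jP+c) (n∣m*n (j / q * P))
  where
  rearrange : ∀ r k q P c → (r + k * q) * P + c ≡ k * P * q + (r * P + c)
  rearrange = solve-∀
  split : j * P + c ≡ j / q * P * q + (j % q * P + c)
  split = trans (cong (λ z → z * P + c) (m≡m%n+[m/n]*n j q)) (rearrange (j % q) (j / q) q P c)

∃-solution : Prime q → ¬ q ∣ P → ∀ c → ∃[ j ] j < q × q ∣ j * P + c
∃-solution {q} {P} q-prime q∤P c = (c * x) % q , m%n<n (c * x) q , ∣-reduce-coefficient (c * x) P c q∣cxP+c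
  where
  instance
    q≢0 : NonZero q
    q≢0 = prime⇒nonZero q-prime
  inverse : ∃[ x ] q ∣ x * P + 1
  inverse = ∃-negative-inverse (Equivalence.from (coprime-prime⇔ q-prime) q∤P)
  x : ℕ
  x = proj₁ inverse
  expand : ∀ c x P → c * (x * P + 1) ≡ c * x * P + c
  expand = solve-∀
  q∣cxP+c : q ∣ c * x * P + c
  q∣cxP+c = subst (q ∣_) (expand c x P) (∣n⇒∣m*n c (proj₂ inverse))

solution-unique≤ : Prime q → ¬ q ∣ P → ∀ {i j} → i ≤ j → j < q →
                   q ∣ i * P + c → q ∣ j * P + c → i ≡ j
solution-unique≤ {q} {P} {c} q-prime q∤P {i} {j} i≤j j<q q∣i q∣j = close-gap (m≤n⇒∃[o]m+o≡n i≤j)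
  where
  shift : ∀ i d P c → (i + d) * P + c ≡ (i * P + c) + d * P
  shift = solve-∀
  close-gap : ∃[ d ] i + d ≡ j → i ≡ j
  close-gap (zero  , refl) = sym (+-identityʳ i)
  close-gap (suc d , refl)
    with euclidsLemma (suc d) P q-prime (∣m+n∣m⇒∣n (subst (q ∣_) (shift i (suc d) P c) q∣j) q∣i)
  ... | inj₁ q∣d = contradiction (≤-trans (∣⇒≤ q∣d) (m≤n+m (suc d) i)) (<⇒≱ j<q)
  ... | inj₂ q∣P = contradiction q∣P q∤P

solution-unique : Prime q → ¬ q ∣ P → ∀ {i j} → i < q → j < q →
                  q ∣ i * P + c → q ∣ j * P + c → i ≡ j
solution-unique q-prime q∤P {i} {j} i<q j<q q∣i q∣j with ≤-total i j
... | inj₁ i≤j = solution-unique≤ q-prime q∤P i≤j j<q q∣i q∣j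
... | inj₂ j≤i = sym (solution-unique≤ q-prime q∤P j≤i i<q q∣j q∣i)

∑-𝟙-solutions : Prime q → ¬ q ∣ P → ∀ c → ∑[ j < q ] 𝟙 (q ∣? j * P + c) ≡ 1
∑-𝟙-solutions {q} {P} q-prime q∤P c with ∃-solution q-prime q∤P c
... | j , j<q , q∣j = ∑-𝟙-unique (λ i → q ∣? i * P + c) q j j<q q∣j
                        (λ i i<q q∣i → solution-unique q-prime q∤P i<q j<q q∣i q∣j)

Avoids : ℕ → ℕ → ℕ → Set
Avoids q a t = ¬ q ∣ t × ¬ q ∣ a + t

avoids? : ∀ q a t → Dec (Avoids q a t)
avoids? q a t = ¬? (q ∣? t) ×-dec ¬? (q ∣? a + t)

∑-𝟙-avoids : Prime q → ¬ q ∣ P → ¬ q ∣ a → ∀ c → ∑[ j < q ] 𝟙 (avoids? q a (j * P + c)) ≡ q ∸ 2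
∑-𝟙-avoids {q} {P} {a} q-prime q∤P q∤a c = trans (sym (m+n∸n≡m (∑ q avoid) 2)) (cong (_∸ 2) total)
  where
  open ≡-Reasoning
  avoid hit hit+a : ℕ → ℕ
  avoid j = 𝟙 (avoids? q a (j * P + c))
  hit   j = 𝟙 (q ∣? j * P + c)
  hit+a j = 𝟙 (q ∣? a + (j * P + c))
  hits+a : ∑ q hit+a ≡ 1
  hits+a = trans (∑-cong q (λ j _ → cong (𝟙 ∘ (q ∣?_)) (x∙yz≈y∙xz a (j * P) c)))
                 (∑-𝟙-solutions q-prime q∤P (a + c))
  no-double-hit : ∀ {t} → ¬ (q ∣ t × q ∣ a + t)
  no-double-hit {t} (q∣t , q∣a+t) = q∤a (∣m+n∣m⇒∣n (subst (q ∣_) (+-comm a t) q∣a+t) q∣t)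
  total : ∑ q avoid + 2 ≡ q
  total = begin
    ∑ q avoid + 2
      ≡⟨ cong (∑ q avoid +_) (cong₂ _+_ (∑-𝟙-solutions q-prime q∤P c) hits+a) ⟨
    ∑ q avoid + (∑ q hit + ∑ q hit+a)
      ≡⟨ trans (∑-+ q avoid _) (cong (∑ q avoid +_) (∑-+ q hit hit+a)) ⟨
    ∑[ j < q ] (avoid j + (hit j + hit+a j))
      ≡⟨ ∑-cong q (λ j _ → 𝟙-partition no-double-hit (q ∣? _) (q ∣? _)) ⟩
    ∑[ _ < q ] 1
      ≡⟨ trans (∑-const q 1) (*-identityʳ q) ⟩
    q ∎

CoprimePair : ℕ → ℕ → ℕ → Set
CoprimePair a M t = Coprime t M × Coprime (a + t) M

coprimePair? : ∀ a M t → Dec (CoprimePair a M t)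
coprimePair? a M t = coprime? t M ×-dec coprime? (a + t) M

pairCount : ℕ → ℕ → ℕ
pairCount a M = ∑[ t < M ] 𝟙 (coprimePair? a M t)

coprimePair-periodic : ∀ {a M t} k → CoprimePair a M (k * M + t) ⇔ CoprimePair a M t
coprimePair-periodic {a} {M} {t} k
  rewrite x∙yz≈y∙xz a (k * M) t = coprime-periodic k ×-⇔ coprime-periodic k

coprimePair-*-prime : Prime q → CoprimePair a (P * q) t ⇔ (Avoids q a t × CoprimePair a P t)
coprimePair-*-prime {q} {P = P} q-prime = mk⇔
  (λ (t⊥Pq , a+t⊥Pq) → let (t⊥P , q∤t) = to split t⊥Pq ; (a+t⊥P , q∤a+t) = to split a+t⊥Pq
                        in (q∤t , q∤a+t) , (t⊥P , a+t⊥P))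
  (λ ((q∤t , q∤a+t) , (t⊥P , a+t⊥P)) → from split (t⊥P , q∤t) , from split (a+t⊥P , q∤a+t))
  where
  open Equivalence
  split : ∀ {x} → Coprime x (P * q) ⇔ (Coprime x P × ¬ q ∣ x)
  split = coprime-*-prime⇔ q-prime

pairCount-*-prime : Prime q → ¬ q ∣ P → ¬ q ∣ a → pairCount a (P * q) ≡ (q ∸ 2) * pairCount a P
pairCount-*-prime {q} {P} {a} q-prime q∤P q∤a = begin
  ∑ (P * q) pair[Pq]
    ≡⟨ cong (λ n → ∑ n pair[Pq]) (*-comm P q) ⟩
  ∑ (q * P) pair[Pq]
    ≡⟨ ∑-blocks q P pair[Pq] ⟩
  ∑[ j < q ] ∑[ i < P ] pair[Pq] (j * P + i)
    ≡⟨ ∑-cong q (λ j _ → ∑-cong P (λ i _ → factorise-term j i)) ⟩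
  ∑[ j < q ] ∑[ i < P ] (avoid j i * pair[P] i)
    ≡⟨ ∑-comm P q _ ⟩
  ∑[ i < P ] ∑[ j < q ] (avoid j i * pair[P] i)
    ≡⟨ ∑-cong P (λ i _ → ∑-*ʳ q (pair[P] i) (λ j → avoid j i)) ⟩
  ∑[ i < P ] (∑[ j < q ] avoid j i * pair[P] i)
    ≡⟨ ∑-cong P (λ i _ → cong (_* pair[P] i) (∑-𝟙-avoids q-prime q∤P q∤a i)) ⟩
  ∑[ i < P ] ((q ∸ 2) * pair[P] i)
    ≡⟨ ∑-*ˡ P (q ∸ 2) pair[P] ⟩
  (q ∸ 2) * pairCount a P ∎
  where
  open ≡-Reasoning
  pair[Pq] pair[P] : ℕ → ℕ
  pair[Pq] t = 𝟙 (coprimePair? a (P * q) t)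
  pair[P]  t = 𝟙 (coprimePair? a P t)
  avoid : ℕ → ℕ → ℕ
  avoid j i = 𝟙 (avoids? q a (j * P + i))
  factorise-term : ∀ j i → pair[Pq] (j * P + i) ≡ avoid j i * pair[P] i
  factorise-term j i = begin
    pair[Pq] x
      ≡⟨ 𝟙-cong (coprimePair-*-prime {a = a} {P} q-prime) (coprimePair? a (P * q) x) (avoid? ×-dec pair?) ⟩
    𝟙 (avoid? ×-dec pair?)
      ≡⟨ 𝟙-× avoid? pair? ⟩
    avoid j i * pair[P] x
      ≡⟨ cong (avoid j i *_) (𝟙-cong (coprimePair-periodic {a} j) pair? (coprimePair? a P i)) ⟩
    avoid j i * pair[P] i ∎
    where
    x : ℕ
    x = j * P + i
    avoid? : Dec (Avoids q a x)
    avoid? = avoids? q a x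
    pair? : Dec (CoprimePair a P x)
    pair? = coprimePair? a P x

∃-prime-divisor : 2 ≤ n → ∃[ r ] Prime r × r ∣ n
∃-prime-divisor {suc n} 2≤n with factorise (suc n)
... | record { factors = [] ; isFactorisation = n≡1 } = contradiction n≡1 (>⇒≢ 2≤n)
... | record { factors = r ∷ rs ; isFactorisation = n≡r*rs ; factorsPrime = r-prime ∷ _ } =
  r , r-prime , subst (r ∣_) (sym n≡r*rs) (m∣m*n (product rs))

m≤n⇒m∣n! : 1 ≤ d → d ≤ n → d ∣ n !
m≤n⇒m∣n! {suc d} _ d≤n = ∣-trans (m∣m*n (d !)) (m≤n⇒m!∣n! d≤n)

∃-prime-between : 1 ≤ n → ∃[ r ] Prime r × n < r × r ≤ 1 + n !
∃-prime-between {n} 1≤n with ∃-prime-divisor (s≤s (1≤n! n))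
... | r , r-prime , r∣1+n! = r , r-prime , n<r , ∣⇒≤ r∣1+n!
  where
  n<r : n < r
  n<r with n <? r
  ... | yes n<r = n<r
  ... | no  n≮r = contradiction
    (∣1⇒≡1 (∣m+n∣m⇒∣n (subst (r ∣_) (+-comm 1 (n !)) r∣1+n!) r∣n!))
    (prime≢1 r-prime)
    where
    r∣n! : r ∣ n !
    r∣n! = m≤n⇒m∣n! (>-nonZero⁻¹ r {{prime⇒nonZero r-prime}}) (≮⇒≥ n≮r)

firstPrimeFrom-prime : ∀ lo k d {r} → Prime r → lo ≤ r → r < lo + k →
                       Prime (firstPrimeFrom lo k d) × lo ≤ firstPrimeFrom lo k d
firstPrimeFrom-prime lo zero    d {r} r-prime lo≤r r<lo =
  contradiction (subst (r <_) (+-identityʳ lo) r<lo) (≤⇒≯ lo≤r)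
firstPrimeFrom-prime lo (suc k) d {r} r-prime lo≤r r<lo+k with prime? lo
... | yes lo-prime = lo-prime , ≤-refl
... | no ¬lo-prime with m≤n⇒m<n∨m≡n lo≤r
...   | inj₂ refl = contradiction r-prime ¬lo-prime
...   | inj₁ lo<r = map₂ (≤-trans (n≤1+n lo))
                         (firstPrimeFrom-prime (suc lo) k d r-prime lo<r (subst (r <_) (+-suc lo k) r<lo+k))

nextPrime-prime : 1 ≤ n → Prime (nextPrime n) × n < nextPrime n
nextPrime-prime {n} 1≤n with ∃-prime-between 1≤n
... | r , r-prime , n<r , r≤1+n! =
  firstPrimeFrom-prime (suc n) (n !) 0 r-prime n<r (s≤s (≤-trans r≤1+n! (+-monoˡ-≤ (n !) 1≤n)))

p-positive : ∀ i → 1 ≤ p i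
p-positive zero    = s≤s z≤n
p-positive (suc i) = ≤-trans (p-positive i) (<⇒≤ (proj₂ (nextPrime-prime (p-positive i))))

p-prime : ∀ i → Prime (p (suc i))
p-prime i = proj₁ (nextPrime-prime (p-positive i))

p-strictMono : ∀ {i j} → i < j → p i < p j
p-strictMono {i} {suc j} i<1+j with m<1+n⇒m<n∨m≡n i<1+j
... | inj₁ i<j  = <-trans (p-strictMono i<j) (proj₂ (nextPrime-prime (p-positive j)))
... | inj₂ refl = proj₂ (nextPrime-prime (p-positive i))

p∤primorial : ∀ {m n} → m < n → ¬ p n ∣ primorial m
p∤primorial {zero}  {suc n} _       pn∣1 = prime≢1 (p-prime n) (∣1⇒≡1 pn∣1)
p∤primorial {suc m} {suc n} 1+m<1+n pn∣primorial
  with euclidsLemma (primorial m) (p (suc m)) (p-prime n) pn∣primorial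
... | inj₁ pn∣primorial-m = p∤primorial (<-trans (n<1+n m) 1+m<1+n) pn∣primorial-m
... | inj₂ pn∣pm          = <⇒≱ (p-strictMono 1+m<1+n) (∣⇒≤ {{prime⇒nonZero (p-prime m)}} pn∣pm)

shares-factor : d ≢ 1 → d ∣ t → d ∣ n → ¬ Coprime t n
shares-factor d≢1 d∣t d∣n t⊥n = d≢1 (t⊥n (d∣t , d∣n))

-- The top four points t = M + 1 - j of the window, written with M = j + s so that each common
-- factor (5 of t + 4, 2 of t, 3 of t + 4, 2 of t) is visible by computation.
¬coprimePair-near-end : ∀ j s → j ≤ 3 → 2 ∣ j + s → 3 ∣ j + s → 5 ∣ j + s →
                        ¬ CoprimePair 4 (j + s) (suc s)
¬coprimePair-near-end 0 s _ _   _   5∣M (_ , ⊥M) = shares-factor (λ ()) (∣m∣n⇒∣m+n ∣-refl 5∣M) 5∣M ⊥M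
¬coprimePair-near-end 1 s _ 2∣M _   _   (⊥M , _) = shares-factor (λ ()) 2∣M 2∣M ⊥M
¬coprimePair-near-end 2 s _ _   3∣M _   (_ , ⊥M) = shares-factor (λ ()) (∣m∣n⇒∣m+n ∣-refl 3∣M) 3∣M ⊥M
¬coprimePair-near-end 3 s _ 2∣M _   _   (⊥M , _) = shares-factor (λ ()) (∣m+n∣m⇒∣n 2∣M ∣-refl) 2∣M ⊥M
¬coprimePair-near-end (suc (suc (suc (suc _)))) s (s≤s (s≤s (s≤s ()))) _ _ _

coprimePair⇒4+t≤1+M : ∀ {M s} → 2 ∣ M → 3 ∣ M → 5 ∣ M →
                       suc s ≤ suc M → CoprimePair 4 M (suc s) → 4 + suc s ≤ suc M
coprimePair⇒4+t≤1+M {M} {s} 2∣M 3∣M 5∣M s≤M pair with 4 + suc s ≤? suc M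
... | yes fits = fits
... | no ¬fits = contradiction pair′ (¬coprimePair-near-end j s j≤3 (∣j+s 2∣M) (∣j+s 3∣M) (∣j+s 5∣M))
  where
  j : ℕ
  j = M ∸ s
  j+s≡M : j + s ≡ M
  j+s≡M = m∸n+n≡m (≤-pred s≤M)
  j≤3 : j ≤ 3
  j≤3 = +-cancelʳ-≤ s j 3 (subst (_≤ 3 + s) (sym j+s≡M) (≤-pred (≤-pred (≰⇒> ¬fits))))
  ∣j+s : ∀ {d} → d ∣ M → d ∣ j + s
  ∣j+s {d} = subst (d ∣_) (sym j+s≡M)
  pair′ : CoprimePair 4 (j + s) (suc s)
  pair′ = subst (λ n → CoprimePair 4 n (suc s)) (sym j+s≡M) pair

cousinPair⇔coprimePair : ∀ m → 30 ∣ primorial m → ∀ {i} → i < primorial m →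
  (Totative m (2 + i) × Totative m (2 + i + 4)) ⇔ CoprimePair 4 (primorial m) (2 + i)
cousinPair⇔coprimePair m 30∣M {i} i<M = mk⇔
  (λ ((_ , _ , t⊥M) , (_ , _ , t+4⊥M)) → t⊥M , subst (λ x → Coprime x M) (+-comm (2 + i) 4) t+4⊥M)
  (λ pair@(t⊥M , 4+t⊥M) → (s≤s (s≤s z≤n) , ≤M+1 (s≤s i<M) , t⊥M)
                        , (s≤s (s≤s z≤n) , ≤M+1 (fits pair)
                          , subst (λ x → Coprime x M) (+-comm 4 (2 + i)) 4+t⊥M))
  where
  M : ℕ
  M = primorial m
  ≤M+1 : ∀ {n} → n ≤ suc M → n ≤ M + 1
  ≤M+1 {n} = subst (n ≤_) (+-comm 1 M)
  fits : CoprimePair 4 M (2 + i) → 2 + i + 4 ≤ suc M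
  fits pair = subst (_≤ suc M) (+-comm 4 (2 + i))
    (coprimePair⇒4+t≤1+M (∣-trans (divides 15 refl) 30∣M) (∣-trans (divides 10 refl) 30∣M)
                         (∣-trans (divides 6 refl) 30∣M) (s≤s i<M) pair)

30∣primorial : ∀ {m} → 3 ≤ m → 30 ∣ primorial m
30∣primorial {suc m} 3≤1+m with m≤n⇒m<n∨m≡n 3≤1+m
... | inj₁ 3<1+m = ∣m⇒∣m*n (p (suc m)) (30∣primorial (≤-pred 3<1+m))
... | inj₂ refl  = ∣-refl

cousin≡pairCount : ∀ m → 30 ∣ primorial m → cousin m ≡ pairCount 4 (primorial m)
cousin≡pairCount m 30∣M = begin
  cousin m
    ≡⟨ length-filter-applyUpTo cousinPair? (2 +_) M ⟩
  ∑[ i < M ] 𝟙 (cousinPair? (2 + i))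
    ≡⟨ ∑-cong M (λ i i<M → 𝟙-cong (cousinPair⇔coprimePair m 30∣M i<M) _ _) ⟩
  ∑[ i < M ] pair (2 + i)
    ≡⟨ ∑-periodic M pair pair-periodic 2 ⟩
  pairCount 4 M ∎
  where
  open ≡-Reasoning
  M : ℕ
  M = primorial m
  cousinPair? : ∀ t → Dec (Totative m t × Totative m (t + 4))
  cousinPair? t = totative? m t ×-dec totative? m (t + 4)
  pair : ℕ → ℕ
  pair t = 𝟙 (coprimePair? 4 M t)
  pair-periodic : ∀ t → pair (M + t) ≡ pair t
  pair-periodic t = trans (cong (λ n → pair (n + t)) (sym (*-identityˡ M)))
                          (𝟙-cong (coprimePair-periodic 1) (coprimePair? 4 M (1 * M + t)) (coprimePair? 4 M t))

corollary3 : (cousin 1 ≡ 0) × (cousin 2 ≡ 0) × (cousin 3 ≡ 3)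
    × (∀ (n : ℕ) → 3 < n → cousin n ≡ (p n ∸ 2) * cousin (n ∸ 1))
corollary3 = refl , refl , refl , recurrence
  where
  recurrence : ∀ n → 3 < n → cousin n ≡ (p n ∸ 2) * cousin (n ∸ 1)
  recurrence (suc n) (s≤s 3≤n) = begin
    cousin (suc n)
      ≡⟨ cousin≡pairCount (suc n) (30∣primorial (m≤n⇒m≤1+n 3≤n)) ⟩
    pairCount 4 (primorial n * p (suc n))
      ≡⟨ pairCount-*-prime {P = primorial n} (p-prime n) (p∤primorial (n<1+n n)) p∤4 ⟩
    (p (suc n) ∸ 2) * pairCount 4 (primorial n)
      ≡⟨ cong ((p (suc n) ∸ 2) *_) (cousin≡pairCount n (30∣primorial 3≤n)) ⟨
    (p (suc n) ∸ 2) * cousin n ∎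
    where
    open ≡-Reasoning
    4<p[1+n] : 4 < p (suc n)
    -- p 3 evaluates to 5
    4<p[1+n] = <-trans {4} {p 3} ≤-refl (p-strictMono (s≤s 3≤n))
    p∤4 : ¬ p (suc n) ∣ 4
    p∤4 p∣4 = <⇒≱ 4<p[1+n] (∣⇒≤ p∣4)
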